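{- Let $(I,J)$ be an instance of \textsc{Variable-Sized Bin Covering} with unit supply such that NFD gives a solution with $k\ge 2$ well-covered bins. If at least one of these well-covered bins contains at least three items, then $\mathrm{OPT}(I,J)/\mathrm{NFD}(I,J)\le 9/4$.
   Context: Unit supply \textsc{Variable-Sized Bin Covering}: $m$ individual bins with demands $d_1\ge\dots\ge d_m>0$ and profit equal to demand, items with sizes $s_1\ge\dots\ge s_n>0$; a bin is covered if its assigned items have total size at least its demand; the goal is to maximize the total demand of covered bins; $\mathrm{OPT}$ is the optimum. Algorithm NFD: with $i=1,j=1$, while $j\le n$ and $i\le m$: if $\sum_{l=j}^n s_l<d_i$ leave bin $i$ empty and set $i:=i+1$; otherwise assign items $j,\dots,j'$ to bin $i$, where $j'$ is the smallest index with $\sum_{l=j}^{j'}s_l\ge d_i$, then $i:=i+1$, $j:=j'+1$. $\mathrm{NFD}(I,J)$ is its profit, $u(i)$ the total size NFD assigns to bin $i$. A bin $i^*$ with $u(i^*)>0$ is well-covered if, letting $i'$ be the smallest index $i'>i^*$ with $u(i')=0$, such $i'$ exists and $u(i)\le 2d_i$ for all $i=1,\dots,i'$.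
   Formalization: The item sizes and the bin demands are rational numbers. -}

module Defs where

open import Data.Bool using (Bool; true; false; if_then_else_)
open import Data.Nat as ℕ using (ℕ; zero; suc)
open import Data.Maybe using (Maybe; just; nothing)
open import Data.List using (List; []; _∷_; length; upTo; map)
open import Data.Product using (_×_; _,_; Σ; ∃)
open import Data.Rational as ℚ using (ℚ; 0ℚ; _+_; _-_; _*_; _≤_; _<_)
open import Data.Rational.Properties using (_≤?_; _<?_)
open import Data.List.Relation.Unary.Linked using (Linked)
open import Relation.Nullary using (yes; no; ¬_)
open import Relation.Binary.PropositionalEquality using (_≡_)

sumℚ : List ℚ → ℚ
sumℚ []       = 0ℚ
sumℚ (x ∷ xs) = x + sumℚ xs

Σ< : ℕ → (ℕ → ℚ) → ℚ
Σ< zero    f = 0ℚ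
Σ< (suc n) f = Σ< n f + f n

at : {A : Set} → A → List A → ℕ → A
at a []       _       = a
at a (x ∷ xs) zero    = x
at a (x ∷ xs) (suc i) = at a xs i

record Instance : Set where
  field
    demands : List ℚ
    sizes   : List ℚ

ValidInstance : Instance → Set
ValidInstance I =
  Linked ℚ._≥_ (Instance.demands I) × Linked ℚ._≥_ (Instance.sizes I) ×
  (∀ i → i ℕ.< length (Instance.demands I) → 0ℚ < at 0ℚ (Instance.demands I) i) ×
  (∀ j → j ℕ.< length (Instance.sizes I) → 0ℚ < at 0ℚ (Instance.sizes I) j)

-- takeUntil d xs = (xs[0..j'], rest) where j' is the smallest index with
-- xs[0] + ... + xs[j'] ≥ d  (only used when sum xs ≥ d)
takeUntil : ℚ → List ℚ → List ℚ × List ℚ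
takeUntil d []       = [] , []
takeUntil d (x ∷ xs) with d ≤? x
... | yes _ = (x ∷ []) , xs
... | no  _ with takeUntil (d - x) xs
...   | (p , r) = (x ∷ p) , r

-- Next Fit Decreasing: the list of items assigned to each bin, in bin order
nfdRun : List ℚ → List ℚ → List (List ℚ)
nfdRun []       items = []
nfdRun (d ∷ ds) items with sumℚ items <? d
... | yes _ = [] ∷ nfdRun ds items
... | no  _ with takeUntil d items
...   | (p , r) = p ∷ nfdRun ds r

nfdBin : Instance → ℕ → List ℚ
nfdBin I i = at [] (nfdRun (Instance.demands I) (Instance.sizes I)) i

u : Instance → ℕ → ℚ
u I i = sumℚ (nfdBin I i)

dem : Instance → ℕ → ℚ
dem I i = at 0ℚ (Instance.demands I) i

profit : Instance → (ℕ → ℚ) → ℚ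
profit I load = Σ< (length (Instance.demands I))
  (λ i → if dem I i ℚ.≤ᵇ load i then dem I i else 0ℚ)

NFD : Instance → ℚ
NFD I = profit I (u I)

-- a feasible (unit supply) assignment: item j goes to bin σ j, or nowhere
Assignment : Set
Assignment = ℕ → Maybe ℕ

isBin : Maybe ℕ → ℕ → Bool
isBin nothing  i = false
isBin (just k) i = k ℕ.≡ᵇ i

load : Instance → Assignment → ℕ → ℚ
load I σ i = Σ< (length (Instance.sizes I))
  (λ j → if isBin (σ j) i then at 0ℚ (Instance.sizes I) j else 0ℚ)

-- profit of an assignment; OPT(I,J) is the maximum of this over all σ
value : Instance → Assignment → ℚ
value I σ = profit I (load I σ)

-- well-covered bin (0-based indices)
WellCovered : Instance → ℕ → Set
WellCovered I i* =
  i* ℕ.< length (Instance.demands I) × 0ℚ < u I i* ×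
  Σ ℕ (λ i' → i' ℕ.< length (Instance.demands I) × i* ℕ.< i' × u I i' ≡ 0ℚ ×
    (∀ i → i* ℕ.< i → i ℕ.< i' → ¬ (u I i ≡ 0ℚ)) ×
    (∀ i → i ℕ.≤ i' → u I i ≤ (ℚ.1ℚ + ℚ.1ℚ) * dem I i))

module Submission where

-- Let x ≠ c be another well-covered bin and r the later of the first empty
-- bins following c and x; so c, x < r, bin r is empty, and u(i) ≤ 2 d_i for
-- all i ≤ r.  Every assignment is worth at most the total item size, which
-- NFD splits as  Σ_{i<r} u(i) + (items still unused when bin r is reached);
-- the unused items total less than d_r, since NFD leaves bin r empty.
-- With F the NFD profit of bins 0..r-1: nonempty NFD bins are covered, so
-- Σ_{i<r} u(i) ≤ 2F - ½ d_c (bin c overshoots d_c by at most its second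
-- item, which is below d_c/2); moreover d_c + d_x ≤ F ≤ NFD and
-- d_r ≤ min(d_c, d_x) by sortedness.  Hence value ≤ 2F - ½ d_c + d_r ≤ 9/4 F.

open import Defs
open import Data.Bool using (true; false; if_then_else_; T)
open import Data.Empty using (⊥-elim)
open import Data.Integer using (+_)
open import Data.List using (List; []; _∷_; length)
open import Data.List.Relation.Unary.All as All using (All; []; _∷_)
open import Data.List.Relation.Unary.Linked as Linked using (Linked; _∷_)
open import Data.List.Relation.Unary.Linked.Properties using (Linked⇒All)
open import Data.Maybe using (just; nothing)
open import Data.Nat as ℕ using (ℕ; zero; suc)
import Data.Nat.Properties as NP
open import Data.Product using (_×_; _,_; Σ; proj₁; proj₂)
open import Data.Sum using (inj₁; inj₂)
open import Data.Rational as ℚ using (ℚ; 0ℚ; 1ℚ; ½; _+_; _-_; _*_; _/_; -_; _≤_; _<_; _≥_)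
import Data.Rational.Properties as QP
open import Data.Rational.Solver using (module +-*-Solver)
open +-*-Solver using (solve; _:+_; _:*_; _:-_; _:=_; con)
open import Relation.Nullary using (¬_; yes; no)
open import Relation.Binary.PropositionalEquality
  using (_≡_; _≢_; refl; sym; trans; cong; cong₂; subst)

p≤p+r : ∀ p {r} → 0ℚ ≤ r → p ≤ p + r
p≤p+r p {r} 0≤r = subst (_≤ p + r) (QP.+-identityʳ p) (QP.+-monoʳ-≤ p 0≤r)

-- p ≤ q, certified by writing q as p plus an explicitly nonnegative term;
-- this is how the linear-arithmetic steps below are discharged.
≤-by-slack : ∀ {p q} r → 0ℚ ≤ r → q ≡ p + r → p ≤ q
≤-by-slack {p} r 0≤r q≡p+r = subst (p ≤_) (sym q≡p+r) (p≤p+r p 0≤r)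

0≤q-p : ∀ {p q} → p ≤ q → 0ℚ ≤ q - p
0≤q-p {p} {q} p≤q = subst (_≤ q - p) (QP.+-inverseʳ p) (QP.+-monoˡ-≤ (- p) p≤q)

0≤+ : ∀ {a b} → 0ℚ ≤ a → 0ℚ ≤ b → 0ℚ ≤ a + b
0≤+ = QP.+-mono-≤

0≤* : ∀ c .{{_ : ℚ.NonNegative c}} {a} → 0ℚ ≤ a → 0ℚ ≤ c * a
0≤* c {a} 0≤a = subst (_≤ c * a) (QP.*-zeroʳ c) (QP.*-monoˡ-≤-nonNeg c 0≤a)

x+[d-x]≡d : ∀ x d → x + (d - x) ≡ d
x+[d-x]≡d = solve 2 (λ x d → x :+ (d :- x) := d) refl

NonnegBelow : ℕ → (ℕ → ℚ) → Set
NonnegBelow n f = ∀ i → i ℕ.< n → 0ℚ ≤ f i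

NonnegBelow-pred : ∀ {n f} → NonnegBelow (suc n) f → NonnegBelow n f
NonnegBelow-pred 0≤f i i<n = 0≤f i (NP.m<n⇒m<1+n i<n)

Σ<-mono : ∀ n {f g : ℕ → ℚ} → (∀ i → i ℕ.< n → f i ≤ g i) → Σ< n f ≤ Σ< n g
Σ<-mono zero    f≤g = QP.≤-refl
Σ<-mono (suc n) f≤g =
  QP.+-mono-≤ (Σ<-mono n (λ i i<n → f≤g i (NP.m<n⇒m<1+n i<n))) (f≤g n NP.≤-refl)

Σ<-zero : ∀ n → Σ< n (λ _ → 0ℚ) ≡ 0ℚ
Σ<-zero zero    = refl
Σ<-zero (suc n) = cong (_+ 0ℚ) (Σ<-zero n)

Σ<-nonneg : ∀ n (f : ℕ → ℚ) → NonnegBelow n f → 0ℚ ≤ Σ< n f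
Σ<-nonneg n f 0≤f = subst (_≤ Σ< n f) (Σ<-zero n) (Σ<-mono n 0≤f)

Σ<-+ : ∀ n (f g : ℕ → ℚ) → Σ< n (λ i → f i + g i) ≡ Σ< n f + Σ< n g
Σ<-+ zero    f g = refl
Σ<-+ (suc n) f g = trans (cong (_+ (f n + g n)) (Σ<-+ n f g))
  (solve 4 (λ a b c d → (a :+ b) :+ (c :+ d) := (a :+ c) :+ (b :+ d)) refl
     (Σ< n f) (Σ< n g) (f n) (g n))

Σ<-swap : ∀ m n (h : ℕ → ℕ → ℚ) →
  Σ< m (λ i → Σ< n (h i)) ≡ Σ< n (λ j → Σ< m (λ i → h i j))
Σ<-swap zero    n h = sym (Σ<-zero n)
Σ<-swap (suc m) n h = trans (cong (_+ Σ< n (h m)) (Σ<-swap m n h))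
  (sym (Σ<-+ n (λ j → Σ< m (λ i → h i j)) (h m)))

Σ<-front : ∀ n (f : ℕ → ℚ) → Σ< (suc n) f ≡ f 0 + Σ< n (λ i → f (suc i))
Σ<-front zero    f = trans (QP.+-identityˡ (f 0)) (sym (QP.+-identityʳ (f 0)))
Σ<-front (suc n) f = trans (cong (_+ f (suc n)) (Σ<-front n f)) (QP.+-assoc (f 0) _ _)

sumℚ-as-Σ< : ∀ xs → sumℚ xs ≡ Σ< (length xs) (at 0ℚ xs)
sumℚ-as-Σ< []       = refl
sumℚ-as-Σ< (x ∷ xs) =
  trans (cong (λ s → x + s) (sumℚ-as-Σ< xs)) (sym (Σ<-front (length xs) (at 0ℚ (x ∷ xs))))

Σ<-prefix : ∀ {a} m (f : ℕ → ℚ) → a ℕ.≤ m → NonnegBelow m f → Σ< a f ≤ Σ< m f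
Σ<-prefix zero    f ℕ.z≤n 0≤f = QP.≤-refl
Σ<-prefix (suc m) f a≤1+m 0≤f with NP.m≤n⇒m<n∨m≡n a≤1+m
... | inj₂ refl   = QP.≤-refl
... | inj₁ a<1+m  = QP.≤-trans
  (Σ<-prefix m f (NP.≤-pred a<1+m) (NonnegBelow-pred 0≤f))
  (p≤p+r (Σ< m f) (0≤f m NP.≤-refl))

Σ<-surplus : ∀ n (f g : ℕ → ℚ) c r → c ℕ.< n →
  (∀ i → i ℕ.< n → i ≢ c → f i ≤ g i) → f c + r ≤ g c → Σ< n f + r ≤ Σ< n g
Σ<-surplus (suc n) f g c r c<1+n f≤g surplus with c ℕ.≟ n
... | yes refl = subst (_≤ Σ< n g + g c) (sym (QP.+-assoc (Σ< n f) (f c) r))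
  (QP.+-mono-≤ (Σ<-mono n (λ i i<n → f≤g i (NP.m<n⇒m<1+n i<n) (λ { refl → NP.<-irrefl refl i<n })))
               surplus)
... | no c≢n = subst (_≤ Σ< n g + g n)
  (solve 3 (λ a b c → (a :+ c) :+ b := (a :+ b) :+ c) refl (Σ< n f) (f n) r)
  (QP.+-mono-≤ (Σ<-surplus n f g c r (NP.≤∧≢⇒< (NP.≤-pred c<1+n) c≢n)
                  (λ i i<n → f≤g i (NP.m<n⇒m<1+n i<n)) surplus)
               (f≤g n NP.≤-refl (λ n≡c → c≢n (sym n≡c))))

Σ<-single : ∀ n (f : ℕ → ℚ) c → c ℕ.< n → NonnegBelow n f → f c ≤ Σ< n f
Σ<-single n f c c<n 0≤f = subst (_≤ Σ< n f) zeros+fc≡fc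
  (Σ<-surplus n (λ _ → 0ℚ) f c (f c) c<n (λ i i<n _ → 0≤f i i<n)
     (QP.≤-reflexive (QP.+-identityˡ (f c))))
  where
  zeros+fc≡fc : Σ< n (λ _ → 0ℚ) + f c ≡ f c
  zeros+fc≡fc = trans (cong (_+ f c) (Σ<-zero n)) (QP.+-identityˡ (f c))

Σ<-pair : ∀ n (f : ℕ → ℚ) c x → c ≢ x → c ℕ.< n → x ℕ.< n →
  NonnegBelow n f → f c + f x ≤ Σ< n f
Σ<-pair (suc n) f c x c≢x c<1+n x<1+n 0≤f with c ℕ.≟ n | x ℕ.≟ n
... | yes refl | yes refl = ⊥-elim (c≢x refl)
... | yes refl | no x≢n   = subst (_≤ Σ< n f + f c) (QP.+-comm (f x) (f c))
  (QP.+-monoˡ-≤ (f c) (Σ<-single n f x (NP.≤∧≢⇒< (NP.≤-pred x<1+n) x≢n)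
    (NonnegBelow-pred 0≤f)))
... | no c≢n   | yes refl = QP.+-monoˡ-≤ (f x)
  (Σ<-single n f c (NP.≤∧≢⇒< (NP.≤-pred c<1+n) c≢n) (NonnegBelow-pred 0≤f))
... | no c≢n   | no x≢n   = QP.≤-trans
  (Σ<-pair n f c x c≢x (NP.≤∧≢⇒< (NP.≤-pred c<1+n) c≢n) (NP.≤∧≢⇒< (NP.≤-pred x<1+n) x≢n)
    (NonnegBelow-pred 0≤f))
  (p≤p+r (Σ< n f) (0≤f n NP.≤-refl))

indicator-below : ∀ m k s → m ℕ.≤ k → Σ< m (λ i → if k ℕ.≡ᵇ i then s else 0ℚ) ≡ 0ℚ
indicator-below zero    k s _   = refl
indicator-below (suc m) k s m<k with k ℕ.≡ᵇ m in k≡ᵇm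
... | true  = ⊥-elim (NP.<-irrefl (sym (NP.≡ᵇ⇒≡ k m (subst T (sym k≡ᵇm) _))) m<k)
... | false = cong (_+ 0ℚ) (indicator-below m k s (NP.<⇒≤ m<k))

indicator-sum : ∀ m k s → 0ℚ ≤ s → Σ< m (λ i → if k ℕ.≡ᵇ i then s else 0ℚ) ≤ s
indicator-sum zero    k s 0≤s = 0≤s
indicator-sum (suc m) k s 0≤s with k ℕ.≡ᵇ m in k≡ᵇm
... | true  rewrite NP.≡ᵇ⇒≡ k m (subst T (sym k≡ᵇm) _) | indicator-below m m s NP.≤-refl =
  QP.≤-reflexive (QP.+-identityˡ s)
... | false = subst (_≤ s) (sym (QP.+-identityʳ _)) (indicator-sum m k s 0≤s)

-- Profit and the value of an assignment

gain : ℚ → ℚ → ℚ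
gain d l = if d ℚ.≤ᵇ l then d else 0ℚ

gain≤load : ∀ d l → 0ℚ ≤ l → gain d l ≤ l
gain≤load d l 0≤l with d ℚ.≤ᵇ l in d≤ᵇl
... | true  = QP.≤ᵇ⇒≤ (subst T (sym d≤ᵇl) _)
... | false = 0≤l

gain-nonneg : ∀ d l → 0ℚ ≤ d → 0ℚ ≤ gain d l
gain-nonneg d l 0≤d with d ℚ.≤ᵇ l
... | true  = 0≤d
... | false = QP.≤-refl

gain-covered : ∀ d l → d ≤ l → gain d l ≡ d
gain-covered d l d≤l with d ℚ.≤ᵇ l in d≤ᵇl
... | true  = refl
... | false = ⊥-elim (subst T d≤ᵇl (QP.≤⇒≤ᵇ d≤l))

load≤2gain : ∀ d l → l ≤ (1ℚ + 1ℚ) * d → (0ℚ < l → d ≤ l) → l ≤ gain d l + gain d l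
load≤2gain d l l≤2d covers with d ℚ.≤ᵇ l in d≤ᵇl
... | true  = subst (l ≤_) (solve 1 (λ d → (con 1ℚ :+ con 1ℚ) :* d := d :+ d) refl d) l≤2d
... | false = QP.≮⇒≥ (λ 0<l → subst T d≤ᵇl (QP.≤⇒≤ᵇ (covers 0<l)))

value≤total-size : (I : Instance) →
  NonnegBelow (length (Instance.sizes I)) (at 0ℚ (Instance.sizes I)) →
  (σ : Assignment) → value I σ ≤ sumℚ (Instance.sizes I)
value≤total-size I 0≤size σ = begin
  value I σ                              ≤⟨ Σ<-mono m (λ i _ → gain≤load (dem I i) _ (load-nonneg i)) ⟩
  Σ< m (load I σ)                        ≡⟨ Σ<-swap m n share ⟩
  Σ< n (λ j → Σ< m (λ i → share i j))    ≤⟨ Σ<-mono n counted-once ⟩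
  Σ< n (at 0ℚ sizes)                     ≡⟨ sym (sumℚ-as-Σ< sizes) ⟩
  sumℚ sizes                             ∎
  where
  open QP.≤-Reasoning
  sizes : List ℚ
  sizes = Instance.sizes I
  m n : ℕ
  m = length (Instance.demands I)
  n = length sizes
  share : ℕ → ℕ → ℚ
  share i j = if isBin (σ j) i then at 0ℚ sizes j else 0ℚ
  load-nonneg : ∀ i → 0ℚ ≤ load I σ i
  load-nonneg i = Σ<-nonneg n (share i) share-nonneg
    where
    share-nonneg : NonnegBelow n (share i)
    share-nonneg j j<n with isBin (σ j) i
    ... | true  = 0≤size j j<n
    ... | false = QP.≤-refl
  counted-once : ∀ j → j ℕ.< n → Σ< m (λ i → share i j) ≤ at 0ℚ sizes j
  counted-once j j<n with σ j
  ... | nothing = subst (_≤ at 0ℚ sizes j) (sym (Σ<-zero m)) (0≤size j j<n)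
  ... | just k  = indicator-sum m k (at 0ℚ sizes j) (0≤size j j<n)

-- One step of NFD: filling a bin of demand d from a list of items

taken left : ℚ → List ℚ → List ℚ
taken d xs = proj₁ (takeUntil d xs)
left  d xs = proj₂ (takeUntil d xs)

takeUntil-split : ∀ d xs → sumℚ xs ≡ sumℚ (taken d xs) + sumℚ (left d xs)
takeUntil-split d []       = refl
takeUntil-split d (x ∷ xs) with d ℚ.≤? x
... | yes _ = cong (_+ sumℚ xs) (sym (QP.+-identityʳ x))
... | no  _ = trans (cong (λ s → x + s) (takeUntil-split (d - x) xs))
                    (sym (QP.+-assoc x _ _))

takeUntil-reaches : ∀ d xs → ¬ (sumℚ xs < d) → d ≤ sumℚ (taken d xs)
takeUntil-reaches d []       total≮d = QP.≮⇒≥ total≮d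
takeUntil-reaches d (x ∷ xs) total≮d with d ℚ.≤? x
... | yes d≤x = subst (d ≤_) (sym (QP.+-identityʳ x)) d≤x
... | no  _   = subst (_≤ x + sumℚ (taken (d - x) xs)) (x+[d-x]≡d x d)
  (QP.+-monoʳ-≤ x (takeUntil-reaches (d - x) xs rest≮d-x))
  where
  rest≮d-x : ¬ (sumℚ xs < d - x)
  rest≮d-x rest<d-x = total≮d (subst (x + sumℚ xs <_) (x+[d-x]≡d x d) (QP.+-monoʳ-< x rest<d-x))

-- The leftover items are a suffix, so they keep any property closed under tails.
TailClosed : (List ℚ → Set) → Set
TailClosed P = ∀ x xs → P (x ∷ xs) → P xs

takeUntil-left : ∀ {P} → TailClosed P → ∀ d xs → P xs → P (left d xs)
takeUntil-left P-tail d []       P[] = P[]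
takeUntil-left P-tail d (x ∷ xs) Pxs with d ℚ.≤? x
... | yes _ = P-tail x xs Pxs
... | no  _ = takeUntil-left P-tail (d - x) xs (P-tail x xs Pxs)

takeUntil-overshoot : ∀ e z ys → 0ℚ ≤ e → 0ℚ ≤ z → All (_≤ z) ys → sumℚ (taken e ys) ≤ e + z
takeUntil-overshoot e z []       0≤e 0≤z []           = 0≤+ 0≤e 0≤z
takeUntil-overshoot e z (y ∷ ys) 0≤e 0≤z (y≤z ∷ ys≤z) with e ℚ.≤? y
... | yes _   = QP.≤-trans (QP.≤-reflexive (QP.+-identityʳ y))
  (QP.≤-trans y≤z (subst (_≤ e + z) (QP.+-identityˡ z) (QP.+-monoˡ-≤ z 0≤e)))
... | no  e≰y = subst (y + sumℚ (taken (e - y) ys) ≤_) (solve 3 (λ e y z → y :+ ((e :- y) :+ z) := e :+ z) refl e y z)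
  (QP.+-monoʳ-≤ y (takeUntil-overshoot (e - y) z ys (0≤q-p (QP.<⇒≤ (QP.≰⇒> e≰y))) 0≤z ys≤z))

SortedSizes : List ℚ → Set
SortedSizes xs = Linked _≥_ xs × All (0ℚ ≤_) xs

SortedSizes-tail : TailClosed SortedSizes
SortedSizes-tail _ _ (sorted , nonneg) = Linked.tail sorted , All.tail nonneg

≤-head : ∀ {z ys} → Linked _≥_ (z ∷ ys) → All (_≤ z) ys
≤-head sorted = All.tail (Linked⇒All (λ y≤x z≤y → QP.≤-trans z≤y y≤x) QP.≤-refl sorted)

-- A bin filled with at least three items of a sorted list x₁ ≥ x₂ ≥ … has
-- load at most 3/2·d: the remainder after x₁, x₂ is covered with overshoot
-- at most x₂, so the load is at most d + x₂, and 2x₂ ≤ x₁ + x₂ < d.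
takeUntil-three : ∀ d xs → SortedSizes xs → 3 ℕ.≤ length (taken d xs) →
  sumℚ (taken d xs) ≤ d + ½ * d
takeUntil-three d []       _ ()
takeUntil-three d (x₁ ∷ xs) _ len with d ℚ.≤? x₁
takeUntil-three d (x₁ ∷ xs) _ (ℕ.s≤s ()) | yes _
takeUntil-three d (x₁ ∷ []) _ (ℕ.s≤s ()) | no _
takeUntil-three d (x₁ ∷ x₂ ∷ xs) _ len | no _ with (d - x₁) ℚ.≤? x₂
takeUntil-three d (x₁ ∷ x₂ ∷ xs) _ (ℕ.s≤s (ℕ.s≤s ())) | no _ | yes _
takeUntil-three d (x₁ ∷ x₂ ∷ xs) (x₂≤x₁ ∷ sorted , _ ∷ 0≤x₂ ∷ _) _ | no _ | no d-x₁≰x₂ =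
  ≤-by-slack (((e + x₂) - S) + ½ * (e + (x₁ - x₂)))
    (0≤+ (0≤q-p S≤e+x₂) (0≤* ½ (0≤+ 0≤e (0≤q-p x₂≤x₁))))
    (solve 4 (λ d x₁ x₂ S → d :+ con ½ :* d :=
       (x₁ :+ (x₂ :+ S)) :+ ((((d :- x₁) :- x₂) :+ x₂ :- S)
         :+ con ½ :* (((d :- x₁) :- x₂) :+ (x₁ :- x₂)))) refl d x₁ x₂ S)
  where
  e S : ℚ
  e = (d - x₁) - x₂
  S = sumℚ (taken e xs)
  0≤e : 0ℚ ≤ e
  0≤e = 0≤q-p (QP.<⇒≤ (QP.≰⇒> d-x₁≰x₂))
  S≤e+x₂ : S ≤ e + x₂
  S≤e+x₂ = takeUntil-overshoot e x₂ xs 0≤e 0≤x₂ (≤-head sorted)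

-- The NFD run as a sequence of steps

nfdStep : ℚ → List ℚ → List ℚ × List ℚ
nfdStep d items with sumℚ items ℚ.<? d
... | yes _ = [] , items
... | no  _ = takeUntil d items

binItems rest : ℚ → List ℚ → List ℚ
binItems d items = proj₁ (nfdStep d items)
rest     d items = proj₂ (nfdStep d items)

nfdRun-step : ∀ d ds items → nfdRun (d ∷ ds) items ≡ binItems d items ∷ nfdRun ds (rest d items)
nfdRun-step d ds items with sumℚ items ℚ.<? d
... | yes _ = refl
... | no  _ = refl

nfdStep-split : ∀ d items → sumℚ items ≡ sumℚ (binItems d items) + sumℚ (rest d items)
nfdStep-split d items with sumℚ items ℚ.<? d
... | yes _ = sym (QP.+-identityˡ (sumℚ items))
... | no  _ = takeUntil-split d items

nfdStep-covers : ∀ d items → 0ℚ < sumℚ (binItems d items) → d ≤ sumℚ (binItems d items)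
nfdStep-covers d items 0<load with sumℚ items ℚ.<? d
... | yes _       = ⊥-elim (QP.<-irrefl refl 0<load)
... | no  total≮d = takeUntil-reaches d items total≮d

nfdStep-empty : ∀ d items → 0ℚ < d → sumℚ (binItems d items) ≡ 0ℚ → sumℚ items < d
nfdStep-empty d items 0<d load≡0 with sumℚ items ℚ.<? d
... | yes total<d = total<d
... | no  total≮d = ⊥-elim (QP.<-irrefl refl
  (QP.<-≤-trans 0<d (subst (d ≤_) load≡0 (takeUntil-reaches d items total≮d))))

nfdStep-three : ∀ d items → SortedSizes items → 3 ℕ.≤ length (binItems d items) →
  sumℚ (binItems d items) ≤ d + ½ * d
nfdStep-three d items sorted len with sumℚ items ℚ.<? d
nfdStep-three d items sorted () | yes _
... | no _ = takeUntil-three d items sorted len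

nfdStep-rest : ∀ {P} → TailClosed P → ∀ d items → P items → P (rest d items)
nfdStep-rest P-tail d items P-items with sumℚ items ℚ.<? d
... | yes _ = P-items
... | no  _ = takeUntil-left P-tail d items P-items

unused : List ℚ → List ℚ → ℕ → List ℚ
unused ds       items zero    = items
unused []       items (suc k) = items
unused (d ∷ ds) items (suc k) = unused ds (rest d items) k

unused-closed : ∀ {P} → TailClosed P → ∀ k ds items → P items → P (unused ds items k)
unused-closed P-tail zero    ds       items P-items = P-items
unused-closed P-tail (suc k) []       items P-items = P-items
unused-closed P-tail (suc k) (d ∷ ds) items P-items =
  unused-closed P-tail k ds (rest d items) (nfdStep-rest P-tail d items P-items)

nfdRun-at : ∀ k ds items → k ℕ.< length ds →
  at [] (nfdRun ds items) k ≡ binItems (at 0ℚ ds k) (unused ds items k)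
nfdRun-at zero    (d ∷ ds) items _         rewrite nfdRun-step d ds items = refl
nfdRun-at (suc k) (d ∷ ds) items (ℕ.s≤s k<) rewrite nfdRun-step d ds items =
  nfdRun-at k ds (rest d items) k<

nfdRun-split : ∀ K ds items →
  sumℚ items ≡ Σ< K (λ i → sumℚ (at [] (nfdRun ds items) i)) + sumℚ (unused ds items K)
nfdRun-split zero    ds       items = sym (QP.+-identityˡ (sumℚ items))
nfdRun-split (suc K) []       items =
  sym (trans (cong (_+ sumℚ items) (Σ<-zero (suc K))) (QP.+-identityˡ (sumℚ items)))
nfdRun-split (suc K) (d ∷ ds) items rewrite nfdRun-step d ds items
  | Σ<-front K (λ i → sumℚ (at [] (binItems d items ∷ nfdRun ds (rest d items)) i)) =
  begin
    sumℚ items                                        ≡⟨ nfdStep-split d items ⟩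
    sumℚ (binItems d items) + sumℚ (rest d items)     ≡⟨ cong (λ s → sumℚ (binItems d items) + s)
                                                           (nfdRun-split K ds (rest d items)) ⟩
    sumℚ (binItems d items) + (later + sumℚ (unused ds (rest d items) K))
                                                      ≡⟨ sym (QP.+-assoc (sumℚ (binItems d items)) later _) ⟩
    (sumℚ (binItems d items) + later) + sumℚ (unused ds (rest d items) K) ∎
  where
  open Relation.Binary.PropositionalEquality.≡-Reasoning
  later : ℚ
  later = Σ< K (λ i → sumℚ (at [] (nfdRun ds (rest d items)) i))

at≤head : ∀ x xs j → Linked _≥_ (x ∷ xs) → j ℕ.< length (x ∷ xs) → at 0ℚ (x ∷ xs) j ≤ x
at≤head x xs       zero    _              _           = QP.≤-refl
at≤head x (y ∷ ys) (suc j) (y≤x ∷ sorted) (ℕ.s≤s j<) = QP.≤-trans (at≤head y ys j sorted j<) y≤x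

at-antitone : ∀ xs i j → Linked _≥_ xs → i ℕ.≤ j → j ℕ.< length xs → at 0ℚ xs j ≤ at 0ℚ xs i
at-antitone (x ∷ xs) zero    j       sorted _          j< = at≤head x xs j sorted j<
at-antitone (x ∷ xs) (suc i) (suc j) sorted (ℕ.s≤s i≤j) (ℕ.s≤s j<) =
  at-antitone xs i j (Linked.tail sorted) i≤j j<

nonneg-entries : ∀ xs → NonnegBelow (length xs) (at 0ℚ xs) → All (0ℚ ≤_) xs
nonneg-entries []       _      = []
nonneg-entries (x ∷ xs) 0≤at = 0≤at 0 (ℕ.s≤s ℕ.z≤n) ∷ nonneg-entries xs (λ j j< → 0≤at (suc j) (ℕ.s≤s j<))

-- The final linear estimate: with U the load of the first r bins, F their
-- profit, d_c, d_x two covered demands among them and d_r a later demand,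
-- U + d_r ≤ 2F - ½d_c + d_r ≤ 2F + ½d_r ≤ 2F + ¼(d_c + d_x) ≤ 9/4·F.
nine-quarters : ∀ U d_c d_x d_r F N → U + ½ * d_c ≤ F + F → F ≤ N → d_c + d_x ≤ F →
  d_r ≤ d_c → d_r ≤ d_x → U + d_r ≤ ((+ 9) / 4) * N
nine-quarters U d_c d_x d_r F N load profit pair r≤c r≤x =
  ≤-by-slack ((((F + F) - (U + ½ * d_c)) + ((+ 9) / 4) * (N - F) + ((+ 1) / 4) * (F - (d_c + d_x)))
               + ((+ 3) / 4) * (d_c - d_r) + ((+ 1) / 4) * (d_x - d_r))
    (0≤+ (0≤+ (0≤+ (0≤+ (0≤q-p load) (0≤* ((+ 9) / 4) (0≤q-p profit)))
                   (0≤* ((+ 1) / 4) (0≤q-p pair)))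
              (0≤* ((+ 3) / 4) (0≤q-p r≤c)))
         (0≤* ((+ 1) / 4) (0≤q-p r≤x)))
    (solve 6 (λ U c x r F N → con ((+ 9) / 4) :* N :=
      (U :+ r) :+ ((((F :+ F) :- (U :+ con ½ :* c)) :+ con ((+ 9) / 4) :* (N :- F)
                     :+ con ((+ 1) / 4) :* (F :- (c :+ x)))
                   :+ con ((+ 3) / 4) :* (c :- r) :+ con ((+ 1) / 4) :* (x :- r)))
      refl U d_c d_x d_r F N)

module NFDAnalysis (I : Instance) (valid : ValidInstance I) where

  demands sizes : List ℚ
  demands = Instance.demands I
  sizes   = Instance.sizes I

  m : ℕ
  m = length demands

  0<dem : ∀ i → i ℕ.< m → 0ℚ < dem I i
  0<dem = proj₁ (proj₂ (proj₂ valid))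

  0≤size : NonnegBelow (length sizes) (at 0ℚ sizes)
  0≤size j j< = QP.<⇒≤ (proj₂ (proj₂ (proj₂ valid)) j j<)

  sizes-sorted : SortedSizes sizes
  sizes-sorted = proj₁ (proj₂ valid) , nonneg-entries sizes 0≤size

  bin-step : ∀ i → i ℕ.< m → nfdBin I i ≡ binItems (dem I i) (unused demands sizes i)
  bin-step i i<m = nfdRun-at i demands sizes i<m

  used⇒covered : ∀ i → i ℕ.< m → 0ℚ < u I i → dem I i ≤ u I i
  used⇒covered i i<m rewrite bin-step i i<m = nfdStep-covers (dem I i) (unused demands sizes i)

  empty⇒shortfall : ∀ i → i ℕ.< m → u I i ≡ 0ℚ → sumℚ (unused demands sizes i) < dem I i
  empty⇒shortfall i i<m rewrite bin-step i i<m =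
    nfdStep-empty (dem I i) (unused demands sizes i) (0<dem i i<m)

  three⇒load : ∀ i → i ℕ.< m → 3 ℕ.≤ length (nfdBin I i) → u I i ≤ dem I i + ½ * dem I i
  three⇒load i i<m rewrite bin-step i i<m = nfdStep-three (dem I i) (unused demands sizes i)
    (unused-closed SortedSizes-tail i demands sizes sizes-sorted)

  earned : ℕ → ℚ
  earned i = gain (dem I i) (u I i)

  earned-nonneg : NonnegBelow m earned
  earned-nonneg i i<m = gain-nonneg (dem I i) (u I i) (QP.<⇒≤ (0<dem i i<m))

  -- A bin r that NFD leaves empty, all bins up to which carry at most
  -- twice their demand; well-covered bins are followed by such a bin.
  ClosingBin : ℕ → Set
  ClosingBin r = r ℕ.< m × u I r ≡ 0ℚ × (∀ i → i ℕ.≤ r → u I i ≤ (1ℚ + 1ℚ) * dem I i)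

  closing-bin-after : ∀ {a} → WellCovered I a → Σ ℕ λ r → ClosingBin r × a ℕ.< r
  closing-bin-after (_ , _ , r , r<m , a<r , empty , _ , bounded) = r , (r<m , empty , bounded) , a<r

  -- Two well-covered bins share a closing bin: the later of their own.
  common-closing-bin : ∀ {a b} → WellCovered I a → WellCovered I b →
    Σ ℕ λ r → ClosingBin r × a ℕ.< r × b ℕ.< r
  common-closing-bin wa wb with closing-bin-after wa | closing-bin-after wb
  ... | ra , closing-a , a<ra | rb , closing-b , b<rb with NP.≤-total ra rb
  ...   | inj₁ ra≤rb = rb , closing-b , NP.<-≤-trans a<ra ra≤rb , b<rb
  ...   | inj₂ rb≤ra = ra , closing-a , a<ra , NP.<-≤-trans b<rb rb≤ra

  nfd-bound : ∀ r c x → ClosingBin r → c ℕ.< r → x ℕ.< r → c ≢ x →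
    0ℚ < u I c → 0ℚ < u I x → 3 ℕ.≤ length (nfdBin I c) →
    (σ : Assignment) → value I σ ≤ ((+ 9) / 4) * NFD I
  nfd-bound r c x (r<m , empty-r , bounded) c<r x<r c≢x used-c used-x three-c σ = begin
    value I σ                          ≤⟨ value≤total-size I 0≤size σ ⟩
    sumℚ sizes                         ≡⟨ nfdRun-split r demands sizes ⟩
    U + sumℚ (unused demands sizes r)  ≤⟨ QP.+-monoʳ-≤ U (QP.<⇒≤ (empty⇒shortfall r r<m empty-r)) ⟩
    U + dem I r                        ≤⟨ nine-quarters U (dem I c) (dem I x) (dem I r) F (NFD I)
                                            load-bound profit-bound pair-bound
                                            (at-antitone demands c r demands-sorted (NP.<⇒≤ c<r) r<m)
                                            (at-antitone demands x r demands-sorted (NP.<⇒≤ x<r) r<m) ⟩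
    ((+ 9) / 4) * NFD I                ∎
    where
    open QP.≤-Reasoning
    demands-sorted : Linked _≥_ demands
    demands-sorted = proj₁ valid
    U F : ℚ
    U = Σ< r (u I)
    F = Σ< r earned
    below-m : ∀ i → i ℕ.< r → i ℕ.< m
    below-m i i<r = NP.<-trans i<r r<m
    earned-c : earned c ≡ dem I c
    earned-c = gain-covered (dem I c) (u I c) (used⇒covered c (below-m c c<r) used-c)
    -- bin c carries at most 3/2·d_c, every other bin at most twice its profit
    load-c : u I c + ½ * dem I c ≤ earned c + earned c
    load-c rewrite earned-c = subst (u I c + ½ * dem I c ≤_)
      (solve 1 (λ d → d :+ con ½ :* d :+ con ½ :* d := d :+ d) refl (dem I c))
      (QP.+-monoˡ-≤ (½ * dem I c) (three⇒load c (below-m c c<r) three-c))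
    load-bound : U + ½ * dem I c ≤ F + F
    load-bound = subst (U + ½ * dem I c ≤_) (Σ<-+ r earned earned)
      (Σ<-surplus r (u I) (λ i → earned i + earned i) c (½ * dem I c) c<r
        (λ i i<r _ → load≤2gain (dem I i) (u I i) (bounded i (NP.<⇒≤ i<r))
                       (used⇒covered i (below-m i i<r)))
        load-c)
    profit-bound : F ≤ NFD I
    profit-bound = Σ<-prefix m earned (NP.<⇒≤ r<m) earned-nonneg
    pair-bound : dem I c + dem I x ≤ F
    pair-bound = subst (_≤ F)
      (cong₂ _+_ earned-c (gain-covered (dem I x) (u I x) (used⇒covered x (below-m x x<r) used-x)))
      (Σ<-pair r earned c x c≢x c<r x<r (λ i i<r → earned-nonneg i (below-m i i<r)))

another-bin : ∀ {P : ℕ → Set} c a b → a ≢ b → P a → P b → Σ ℕ λ x → c ≢ x × P x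
another-bin c a b a≢b Pa Pb with c ℕ.≟ a
... | yes refl = b , a≢b , Pb
... | no  c≢a  = a , c≢a , Pa

lemma8 : (I : Instance) → ValidInstance I →
    (Σ ℕ λ a → Σ ℕ λ b → ¬ (a ≡ b) × WellCovered I a × WellCovered I b) →
    (Σ ℕ λ c → WellCovered I c × 3 ℕ.≤ length (nfdBin I c)) →
    (σ : Assignment) → value I σ ≤ ((+ 9) / 4) * NFD I
lemma8 I valid (a , b , a≢b , wc-a , wc-b) (c , wc-c , three-c) σ
  with another-bin {WellCovered I} c a b a≢b wc-a wc-b
... | x , c≢x , wc-x with NFDAnalysis.common-closing-bin I valid wc-c wc-x
... | r , closing-r , c<r , x<r =
  NFDAnalysis.nfd-bound I valid r c x closing-r c<r x<r c≢x
    (used wc-c) (used wc-x) three-c σ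
  where
  used : ∀ {i} → WellCovered I i → 0ℚ < u I i
  used (_ , 0<u , _) = 0<u
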